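{- Let $U$ be an ultrafilter on $\omega$ and $I$ a deterministic ideal on $\omega$ with $\mathrm{fin}\subseteq I\subseteq U^*$. If $U\not\ge_T I^\omega$, then $U$ has the $I$-pseudo intersection property, i.e. for every sequence $\langle X_n:n<\omega\rangle\subseteq U$ there is $X\in U$ with $X\setminus X_n\in I$ for all $n$.
   Context: $\mathrm{fin}$ is the ideal of finite subsets of $\omega$; $U^*=\{\omega\setminus A:A\in U\}$; for an ideal $I$, $I^*=\{\omega\setminus A:A\in I\}$ is the dual filter. An ideal $I$ is deterministic if there is a cofinal $\mathcal{B}\subseteq I$ (under inclusion) such that for every $\mathcal{A}\subseteq\mathcal{B}$, either $\bigcup\mathcal{A}\in I$ or $\bigcup\mathcal{A}\in I^*$. Ideals are ordered by inclusion, ultrafilters by reverse inclusion, $I^\omega=\prod_{n<\omega}I$ coordinatewise. $P\le_TQ$ (Tukey) iff there is a map $Q\to P$ sending cofinal subsets to cofinal subsets. -}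

module Defs where

open import Data.Nat using (ℕ; _<_)
open import Data.Bool using (Bool; true; false; not; _∧_; _∨_)
open import Data.Product using (Σ; _×_; _,_)
open import Data.Sum using (_⊎_)
open import Relation.Binary.PropositionalEquality using (_≡_)
open import Relation.Nullary using (¬_)

Subset : Set
Subset = ℕ → Bool

_∈ₛ_ : ℕ → Subset → Set
n ∈ₛ X = X n ≡ true

_⊆_ : Subset → Subset → Set
X ⊆ Y = ∀ n → n ∈ₛ X → n ∈ₛ Y

ω : Subset
ω _ = true

∅ : Subset
∅ _ = false

∁ : Subset → Subset
∁ X n = not (X n)

_∖_ : Subset → Subset → Subset
(X ∖ Y) n = X n ∧ not (Y n)

_∪_ : Subset → Subset → Subset
(X ∪ Y) n = X n ∨ Y n

_∩_ : Subset → Subset → Subset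
(X ∩ Y) n = X n ∧ Y n

Finite : Subset → Set
Finite X = Σ ℕ λ b → ∀ n → n ∈ₛ X → n < b

Family : Set₁
Family = Subset → Set

Dual : Family → Family
Dual F X = F (∁ X)

IsUnion : Family → Subset → Set
IsUnion 𝒜 X = ∀ n → (n ∈ₛ X → Σ Subset λ A → 𝒜 A × n ∈ₛ A)
                  × ((Σ Subset λ A → 𝒜 A × n ∈ₛ A) → n ∈ₛ X)

record IsIdeal (I : Family) : Set₁ where
  field
    down  : ∀ X Y → X ⊆ Y → I Y → I X
    union : ∀ X Y → I X → I Y → I (X ∪ Y)
    proper : ¬ I ω

record IsUltrafilter (U : Family) : Set₁ where
  field
    up     : ∀ X Y → X ⊆ Y → U X → U Y
    inter  : ∀ X Y → U X → U Y → U (X ∩ Y)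
    proper : ¬ U ∅
    ultra  : ∀ X → U X ⊎ U (∁ X)

FinSub : Family → Set
FinSub I = ∀ X → Finite X → I X

_⊆ᶠ_ : Family → Family → Set
F ⊆ᶠ G = ∀ X → F X → G X

Deterministic : Family → Set₁
Deterministic I =
  Σ Family λ ℬ →
    (ℬ ⊆ᶠ I)
    × (∀ X → I X → Σ Subset λ B → ℬ B × X ⊆ B)
    × (∀ (𝒜 : Family) → 𝒜 ⊆ᶠ ℬ → ∀ X → IsUnion 𝒜 X → I X ⊎ Dual I X)

record Ord : Set₁ where
  field
    Carrier : Set
    _≤_     : Carrier → Carrier → Set

open Ord

Cofinal : (P : Ord) → (Carrier P → Set) → Set
Cofinal P 𝒞 = ∀ p → Σ (Carrier P) λ c → 𝒞 c × _≤_ P p c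

-- P ≤_T Q : some map Q → P sends cofinal subsets of Q to cofinal subsets of P
-- (f[𝒞] cofinal in P, written out)
_≤T_ : Ord → Ord → Set₁
P ≤T Q = Σ (Carrier Q → Carrier P) λ f →
           ∀ (𝒞 : Carrier Q → Set) → Cofinal Q 𝒞 →
             ∀ p → Σ (Carrier Q) λ q → 𝒞 q × _≤_ P p (f q)

UltOrd : Family → Ord
UltOrd U = record { Carrier = Σ Subset U
                  ; _≤_ = λ { (A , _) (B , _) → B ⊆ A } }

IdealPow : Family → Ord
IdealPow I = record { Carrier = Σ (ℕ → Subset) (λ s → ∀ n → I (s n))
                    ; _≤_ = λ { (s , _) (t , _) → ∀ n → s n ⊆ t n } }

IPseudoIntersection : Family → Family → Set
IPseudoIntersection I U =
  ∀ (Xs : ℕ → Subset) → (∀ n → U (Xs n)) →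
    Σ Subset λ X → U X × (∀ n → I (X ∖ Xs n))

{-# OPTIONS --safe #-}
-- Assume the I-pseudo intersection property fails for ⟨Xₙ⟩, and replace Xₙ by the
-- decreasing sequence Xₙ' = X₀ ∩ ⋯ ∩ Xₙ.  Send A ∈ U to the sequence whose n-th term is
-- the union of all basis sets B ∈ ℬ missing A ∩ Xₙ'; determinacy and I ⊆ U* put it in I.
-- This map is Tukey: given s ∈ I^ω, cover each sₙ by some Bₙ ∈ ℬ and let W = ⋃ₙ Bₙ ∩ Xₙ'.
-- Since W ∖ Xₙ ⊆ B₀ ∪ ⋯ ∪ Bₙ₋₁ ∈ I, W would be an I-pseudo intersection, so ω ∖ W ∈ U;
-- every A ⊆ ω ∖ W in a cofinal family has Bₙ missing A ∩ Xₙ', hence sₙ ⊆ Bₙ ⊆ (image of A)ₙ.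
module Submission where

open import Defs
open Ord using (Carrier)
open import Level using (0ℓ)
open import Axiom.ExcludedMiddle using (ExcludedMiddle)
open import Data.Nat using (ℕ; zero; suc; _≤′_; _<′_; ≤′-refl; ≤′-step; _<?_)
open import Data.Nat.Properties using (≤⇒≤′; ≮⇒≥)
open import Data.Bool using (true; false; not; _∧_; _∨_)
open import Data.Bool.Properties using (∧-conicalˡ; ∧-conicalʳ)
open import Data.Product using (Σ; _×_; _,_; proj₁; proj₂; map₂)
open import Data.Sum using (_⊎_; inj₁; inj₂)
open import Data.Empty using (⊥; ⊥-elim)
open import Relation.Nullary using (¬_; yes; no; does)
open import Relation.Nullary.Decidable using (dec-true)
open import Relation.Binary.PropositionalEquality using (_≡_; refl)

∧-true : ∀ {a b} → a ≡ true → b ≡ true → a ∧ b ≡ true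
∧-true refl refl = refl

∨-trueˡ : ∀ {a b} → a ≡ true → a ∨ b ≡ true
∨-trueˡ refl = refl

∨-trueʳ : ∀ {a b} → b ≡ true → a ∨ b ≡ true
∨-trueʳ {true}  _ = refl
∨-trueʳ {false} p = p

not-true : ∀ {b} → not b ≡ true → ¬ b ≡ true
not-true {false} _ ()

not-not-true : ∀ {b} → not (not b) ≡ true → b ≡ true
not-not-true {true} _ = refl

PseudoIntersection : Family → Family → (ℕ → Subset) → Set
PseudoIntersection I U Xs = Σ Subset λ X → U X × (∀ n → I (X ∖ Xs n))

Disjoint : Subset → Subset → Set
Disjoint X Y = ∀ n → n ∈ₛ X → n ∈ₛ Y → ⊥

module Comprehension (lem : ExcludedMiddle 0ℓ) where

  ⟦_⟧ : (ℕ → Set) → Subset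
  ⟦ P ⟧ n = does (lem {P n})

  ∈⟦⟧⁺ : ∀ P {n} → P n → n ∈ₛ ⟦ P ⟧
  ∈⟦⟧⁺ P = dec-true lem

  ∈⟦⟧⁻ : ∀ P {n} → n ∈ₛ ⟦ P ⟧ → P n
  ∈⟦⟧⁻ P {n} p with lem {P n}
  ∈⟦⟧⁻ P {n} _ | yes q = q
  ∈⟦⟧⁻ P {n} () | no _

  InSome : Family → ℕ → Set
  InSome 𝒜 n = Σ Subset λ A → 𝒜 A × n ∈ₛ A

  ⋃ : Family → Subset
  ⋃ 𝒜 = ⟦ InSome 𝒜 ⟧

  ⋃-isUnion : ∀ 𝒜 → IsUnion 𝒜 (⋃ 𝒜)
  ⋃-isUnion 𝒜 n = ∈⟦⟧⁻ (InSome 𝒜) , ∈⟦⟧⁺ (InSome 𝒜)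

  InSomeₙ : (ℕ → Subset) → ℕ → Set
  InSomeₙ Ys m = Σ ℕ λ n → m ∈ₛ Ys n

  ⋃ₙ : (ℕ → Subset) → Subset
  ⋃ₙ Ys = ⟦ InSomeₙ Ys ⟧

  ∈⋃ₙ⁺ : ∀ Ys {m} n → m ∈ₛ Ys n → m ∈ₛ ⋃ₙ Ys
  ∈⋃ₙ⁺ Ys n m∈Yₙ = ∈⟦⟧⁺ (InSomeₙ Ys) (n , m∈Yₙ)

  ∈⋃ₙ⁻ : ∀ Ys {m} → m ∈ₛ ⋃ₙ Ys → InSomeₙ Ys m
  ∈⋃ₙ⁻ Ys = ∈⟦⟧⁻ (InSomeₙ Ys)

⋂≤ : (ℕ → Subset) → ℕ → Subset
⋂≤ Xs zero    = Xs zero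
⋂≤ Xs (suc n) = ⋂≤ Xs n ∩ Xs (suc n)

⋂≤-⊆ : ∀ Xs n → ⋂≤ Xs n ⊆ Xs n
⋂≤-⊆ Xs zero    m p = p
⋂≤-⊆ Xs (suc n) m p = ∧-conicalʳ _ _ p

⋂≤-antitone : ∀ Xs {n k} → n ≤′ k → ⋂≤ Xs k ⊆ ⋂≤ Xs n
⋂≤-antitone Xs ≤′-refl     m p = p
⋂≤-antitone Xs (≤′-step h) m p = ⋂≤-antitone Xs h m (∧-conicalˡ _ _ p)

⋃< : (ℕ → Subset) → ℕ → Subset
⋃< Bs zero    = ∅
⋃< Bs (suc n) = ⋃< Bs n ∪ Bs n

⋃<-⊇ : ∀ Bs {k n} → k <′ n → Bs k ⊆ ⋃< Bs n
⋃<-⊇ Bs ≤′-refl     m p = ∨-trueʳ p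
⋃<-⊇ Bs (≤′-step h) m p = ∨-trueˡ (⋃<-⊇ Bs h m p)

module _ (lem : ExcludedMiddle 0ℓ) where
  open Comprehension lem

  diagonal-∖-⊆-⋃< : ∀ Bs Xs n → (⋃ₙ (λ k → Bs k ∩ ⋂≤ Xs k) ∖ Xs n) ⊆ ⋃< Bs n
  diagonal-∖-⊆-⋃< Bs Xs n m p with ∈⋃ₙ⁻ (λ k → Bs k ∩ ⋂≤ Xs k) (∧-conicalˡ _ _ p)
  ... | k , m∈Bₖ∩Xₖ' with k <? n
  ...   | yes k<n = ⋃<-⊇ Bs (≤⇒≤′ k<n) m (∧-conicalˡ _ _ m∈Bₖ∩Xₖ')
  ...   | no  k≮n = ⊥-elim (not-true (∧-conicalʳ _ _ p)
                      (⋂≤-⊆ Xs n m (⋂≤-antitone Xs (≤⇒≤′ (≮⇒≥ k≮n)) m (∧-conicalʳ _ _ m∈Bₖ∩Xₖ'))))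

module Ultrafilter {U : Family} (uU : IsUltrafilter U) where
  open IsUltrafilter uU

  ¬Disjoint : ∀ {X Y} → U X → U Y → ¬ Disjoint X Y
  ¬Disjoint {X} {Y} uX uY X#Y =
    proper (up _ _ (λ n p → ⊥-elim (X#Y n (∧-conicalˡ _ _ p) (∧-conicalʳ _ _ p))) (inter X Y uX uY))

  ∁-∈ : ∀ {W} → ¬ U W → U (∁ W)
  ∁-∈ {W} W∉U with ultra W
  ... | inj₁ uW  = ⊥-elim (W∉U uW)
  ... | inj₂ u∁W = u∁W

  ⋂≤-∈ : ∀ Xs → (∀ n → U (Xs n)) → ∀ n → U (⋂≤ Xs n)
  ⋂≤-∈ Xs uXs zero    = uXs zero
  ⋂≤-∈ Xs uXs (suc n) = inter _ _ (⋂≤-∈ Xs uXs n) (uXs (suc n))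

module Ideal {I : Family} (iI : IsIdeal I) (finI : FinSub I) where
  open IsIdeal iI

  ∅-∈ : I ∅
  ∅-∈ = finI ∅ (0 , λ n ())

  ⋃<-∈ : ∀ Bs → (∀ n → I (Bs n)) → ∀ n → I (⋃< Bs n)
  ⋃<-∈ Bs iBs zero    = ∅-∈
  ⋃<-∈ Bs iBs (suc n) = union _ _ (⋃<-∈ Bs iBs n) (iBs n)

module Determined (lem : ExcludedMiddle 0ℓ) {U I : Family} (uU : IsUltrafilter U)
                  (ℬ : Family)
                  (ℬ-determined : ∀ 𝒜 → 𝒜 ⊆ᶠ ℬ → ∀ X → IsUnion 𝒜 X → I X ⊎ Dual I X)
                  (I⊆U* : ∀ X → I X → Dual U X) where
  open Comprehension lem
  open IsUltrafilter uU using (up)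
  open Ultrafilter uU using (¬Disjoint)

  ℬ-Avoiding : Subset → Family
  ℬ-Avoiding Y B = ℬ B × Disjoint B Y

  Avoiding : Subset → Subset
  Avoiding Y = ⋃ (ℬ-Avoiding Y)

  ⊆-Avoiding : ∀ {B Y} → ℬ B → Disjoint B Y → B ⊆ Avoiding Y
  ⊆-Avoiding {B} {Y} ℬB B#Y m m∈B = proj₂ (⋃-isUnion (ℬ-Avoiding Y) m) (B , (ℬB , B#Y) , m∈B)

  Avoiding-# : ∀ Y → Disjoint (Avoiding Y) Y
  Avoiding-# Y m p m∈Y with proj₁ (⋃-isUnion (ℬ-Avoiding Y) m) p
  ... | B , (_ , B#Y) , m∈B = B#Y m m∈B m∈Y

  -- The union cannot be co-small, for then it would lie in U together with the set it misses.
  Avoiding-∈ : ∀ {Y} → U Y → I (Avoiding Y)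
  Avoiding-∈ {Y} uY with ℬ-determined (ℬ-Avoiding Y) (λ B → proj₁) (Avoiding Y) (⋃-isUnion _)
  ... | inj₁ small    = small
  ... | inj₂ co-small =
    ⊥-elim (¬Disjoint (up _ _ (λ m → not-not-true) (I⊆U* _ co-small)) uY (Avoiding-# Y))

module NoPseudoIntersection
  (lem : ExcludedMiddle 0ℓ) {U I : Family} (uU : IsUltrafilter U) (iI : IsIdeal I)
  (ℬ : Family) (ℬ⊆I : ℬ ⊆ᶠ I) (ℬ-cofinal : ∀ X → I X → Σ Subset λ B → ℬ B × X ⊆ B)
  (ℬ-determined : ∀ 𝒜 → 𝒜 ⊆ᶠ ℬ → ∀ X → IsUnion 𝒜 X → I X ⊎ Dual I X) (finI : FinSub I)
  (I⊆U* : ∀ X → I X → Dual U X)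
  (Xs : ℕ → Subset) (uXs : ∀ n → U (Xs n))
  (no-pseudo : ¬ PseudoIntersection I U Xs) where

  open Comprehension lem
  open Ultrafilter uU
  open Determined lem uU ℬ ℬ-determined I⊆U*

  tukey-map : Carrier (UltOrd U) → Carrier (IdealPow I)
  tukey-map (A , uA) = (λ n → Avoiding (A ∩ ⋂≤ Xs n))
                     , (λ n → Avoiding-∈ (IsUltrafilter.inter uU _ _ uA (⋂≤-∈ Xs uXs n)))

  module Covering (s : ℕ → Subset) (is : ∀ n → I (s n)) where

    cover : ∀ n → Σ Subset λ B → ℬ B × s n ⊆ B
    cover n = ℬ-cofinal (s n) (is n)

    Bs : ℕ → Subset
    Bs n = proj₁ (cover n)

    W : Subset
    W = ⋃ₙ (λ n → Bs n ∩ ⋂≤ Xs n)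

    ∁W-∈ : U (∁ W)
    ∁W-∈ = ∁-∈ λ uW → no-pseudo (W , uW , λ n →
      IsIdeal.down iI _ _ (diagonal-∖-⊆-⋃< lem Bs Xs n)
        (Ideal.⋃<-∈ iI finI Bs (λ k → ℬ⊆I _ (proj₁ (proj₂ (cover k)))) n))

    Bₙ#A∩Xₙ' : ∀ {A} → A ⊆ ∁ W → ∀ n → Disjoint (Bs n) (A ∩ ⋂≤ Xs n)
    Bₙ#A∩Xₙ' A⊆∁W n m m∈Bₙ m∈A∩Xₙ' =
      not-true (A⊆∁W m (∧-conicalˡ _ _ m∈A∩Xₙ'))
        (∈⋃ₙ⁺ (λ k → Bs k ∩ ⋂≤ Xs k) n (∧-true m∈Bₙ (∧-conicalʳ _ _ m∈A∩Xₙ')))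

    ⊆-Avoiding-∩⋂≤ : ∀ {A} → A ⊆ ∁ W → ∀ n → s n ⊆ Avoiding (A ∩ ⋂≤ Xs n)
    ⊆-Avoiding-∩⋂≤ A⊆∁W n m m∈sₙ =
      ⊆-Avoiding (proj₁ (proj₂ (cover n))) (Bₙ#A∩Xₙ' A⊆∁W n) m (proj₂ (proj₂ (cover n)) m m∈sₙ)

  tukey : IdealPow I ≤T UltOrd U
  tukey = tukey-map , λ 𝒞 𝒞-cofinal (s , is) →
    let open Covering s is in map₂ (map₂ ⊆-Avoiding-∩⋂≤) (𝒞-cofinal (∁ W , ∁W-∈))

theorem5p2 : ExcludedMiddle 0ℓ → ExcludedMiddle (Level.suc 0ℓ) →
    (U I : Family) → IsUltrafilter U → IsIdeal I → Deterministic I →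
    FinSub I → (∀ X → I X → Dual U X) →
    ¬ (IdealPow I ≤T UltOrd U) →
    IPseudoIntersection I U
theorem5p2 lem _ U I uU iI (ℬ , ℬ⊆I , ℬ-cofinal , ℬ-determined) finI I⊆U* U≱ᵀIᵒ Xs uXs
  with lem {PseudoIntersection I U Xs}
... | yes pseudo-intersection = pseudo-intersection
... | no  no-pseudo =
  ⊥-elim (U≱ᵀIᵒ (NoPseudoIntersection.tukey lem uU iI ℬ ℬ⊆I ℬ-cofinal ℬ-determined finI I⊆U*
                               Xs uXs no-pseudo))
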